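{- For all terms $s,t$ over the signature $\Sigma_{\mathrm{BCCSP}_D^c}$, if $s=t$ is derivable from the axiom system $E_{\mathrm{BCCSP}_D^c}$, then $s$ and $t$ are strongly bisimilar with respect to $\mathrm{BCCSP}_D^c$.
   Context: The data signature $\Sigma_D$ is a finite set of constants, and $L$ is a set of action labels. Closed process terms of $\mathrm{BCCSP}_D^c$ are generated by $t ::= \mathbf{0} \mid l.t\ (l\in L) \mid \mathit{check}(d,t) \mid \mathit{update}(d,t) \mid t+t$ with $d$ a data constant (open terms additionally allow process variables and data variables in data positions). The transition system has labels $(d,l,d')$ with $d,d'\in\Sigma_D$, $l\in L$, and is given by the rules (for all data values $x_D,x'_D,y_D$): $l.x_P\xrightarrow{(x_D,l,x_D)}x_P$; if $x_P\xrightarrow{(x_D,l,x'_D)}x'_P$ then $\mathit{check}(x_D,x_P)\xrightarrow{(x_D,l,x'_D)}x'_P$; if $x_P\xrightarrow{(x_D,l,x'_D)}x'_P$ then $\mathit{update}(y_D,x_P)\xrightarrow{(x_D,l,y_D)}x'_P$; if $x_P\xrightarrow{(x_D,l,x'_D)}x'_P$ then $x_P+y_P\xrightarrow{(x_D,l,x'_D)}x'_P$ and $y_P+x_P\xrightarrow{(x_D,l,x'_D)}x'_P$. Strong bisimilarity: a symmetric relation $R$ on closed process terms such that $(p,q)\in R$ and $p\xrightarrow{(d,l,d')}p'$ imply $q\xrightarrow{(d,l,d')}q'$ for some $q'$ with $(p',q')\in R$; $p,q$ are strongly bisimilar if related by such an $R$. For open terms, strong bisimilarity means strong bisimilarity of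 all closed instances. $E_{\mathrm{BCCSP}_D^c}$ consists of: $x_P+y_P=y_P+x_P$; $x_P+(y_P+z_P)=(x_P+y_P)+z_P$; $x_P+x_P=x_P$; $x_P+\mathbf{0}=x_P$; $\mathit{check}(x_D,x_P+y_P)=\mathit{check}(x_D,x_P)+\mathit{check}(x_D,y_P)$; $\mathit{update}(x_D,x_P+y_P)=\mathit{update}(x_D,x_P)+\mathit{update}(x_D,y_P)$; $\mathit{check}(x_D,\mathit{update}(y_D,x_P))=\mathit{update}(y_D,\mathit{check}(x_D,x_P))$; $\mathit{update}(x_D,\mathit{update}(y_D,x_P))=\mathit{update}(x_D,x_P)$; $\mathit{check}(d,\mathit{check}(d,x_P))=\mathit{check}(d,x_P)$ for all $d\in\Sigma_D$; $\mathit{check}(d,\mathit{check}(d',x_P))=\mathbf{0}$ for all $d\neq d'$ in $\Sigma_D$; $l.x_P=\sum_{d\in\Sigma_D}\mathit{update}(d,\mathit{check}(d,l.x_P))$ for all $l\in L$. Derivability means membership in the smallest congruence containing all substitution instances of these equations. -}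

module Defs where

open import Data.Nat using (ℕ)
open import Data.Fin using (Fin)
open import Data.List using (List; []; _∷_; map; allFin)
open import Data.Product using (Σ; _×_)
open import Relation.Binary.PropositionalEquality using (_≡_; _≢_)

module _ (n : ℕ) (L : Set) where

  DVal : Set
  DVal = Fin n

  data DTerm : Set where
    dconst : DVal → DTerm
    dvar   : ℕ → DTerm

  data Term : Set where
    pvar   : ℕ → Term
    nil    : Term
    act    : L → Term → Term
    check  : DTerm → Term → Term
    update : DTerm → Term → Term
    plus   : Term → Term → Term

  data CTerm : Set where
    cnil    : CTerm
    cact    : L → CTerm → CTerm
    ccheck  : DVal → CTerm → CTerm
    cupdate : DVal → CTerm → CTerm
    cplus   : CTerm → CTerm → CTerm

  dsub : (ℕ → DTerm) → DTerm → DTerm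
  dsub δ (dconst d) = dconst d
  dsub δ (dvar i)   = δ i

  sub : (ℕ → Term) → (ℕ → DTerm) → Term → Term
  sub σ δ (pvar i)     = σ i
  sub σ δ nil          = nil
  sub σ δ (act l t)    = act l (sub σ δ t)
  sub σ δ (check d t)  = check (dsub δ d) (sub σ δ t)
  sub σ δ (update d t) = update (dsub δ d) (sub σ δ t)
  sub σ δ (plus t u)   = plus (sub σ δ t) (sub σ δ u)

  dclose : (ℕ → DVal) → DTerm → DVal
  dclose δ (dconst d) = d
  dclose δ (dvar i)   = δ i

  close : (ℕ → CTerm) → (ℕ → DVal) → Term → CTerm
  close σ δ (pvar i)     = σ i
  close σ δ nil          = cnil
  close σ δ (act l t)    = cact l (close σ δ t)
  close σ δ (check d t)  = ccheck (dclose δ d) (close σ δ t)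
  close σ δ (update d t) = cupdate (dclose δ d) (close σ δ t)
  close σ δ (plus t u)   = cplus (close σ δ t) (close σ δ u)

  sumT : List Term → Term
  sumT []           = nil
  sumT (t ∷ [])     = t
  sumT (t ∷ u ∷ ts) = plus t (sumT (u ∷ ts))

  x y z : Term
  x = pvar 0
  y = pvar 1
  z = pvar 2
  xD yD : DTerm
  xD = dvar 0
  yD = dvar 1

  data Ax : Term → Term → Set where
    A1  : Ax (plus x y) (plus y x)
    A2  : Ax (plus x (plus y z)) (plus (plus x y) z)
    A3  : Ax (plus x x) x
    A4  : Ax (plus x nil) x
    C1  : Ax (check xD (plus x y)) (plus (check xD x) (check xD y))
    U1  : Ax (update xD (plus x y)) (plus (update xD x) (update xD y))
    CU  : Ax (check xD (update yD x)) (update yD (check xD x))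
    UU  : Ax (update xD (update yD x)) (update xD x)
    CC  : (d : DVal) → Ax (check (dconst d) (check (dconst d) x)) (check (dconst d) x)
    CC0 : (d d' : DVal) → d ≢ d' → Ax (check (dconst d) (check (dconst d') x)) nil
    Act : (l : L) → Ax (act l x)
                       (sumT (map (λ d → update (dconst d) (check (dconst d) (act l x)))
                                  (allFin n)))

  data Derivable : Term → Term → Set where
    inst   : ∀ {s t} → Ax s t → (σ : ℕ → Term) (δ : ℕ → DTerm) →
             Derivable (sub σ δ s) (sub σ δ t)
    refl'  : ∀ {t} → Derivable t t
    sym'   : ∀ {s t} → Derivable s t → Derivable t s
    trans' : ∀ {s t u} → Derivable s t → Derivable t u → Derivable s u
    cong-act    : ∀ {s t} (l : L) → Derivable s t → Derivable (act l s) (act l t)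
    cong-check  : ∀ {s t} (d : DTerm) → Derivable s t → Derivable (check d s) (check d t)
    cong-update : ∀ {s t} (d : DTerm) → Derivable s t → Derivable (update d s) (update d t)
    cong-plus   : ∀ {s s' t t'} → Derivable s s' → Derivable t t' →
                  Derivable (plus s t) (plus s' t')

  data Step : CTerm → DVal → L → DVal → CTerm → Set where
    s-act    : ∀ {d l p} → Step (cact l p) d l d p
    s-check  : ∀ {d l d' p p'} → Step p d l d' p' → Step (ccheck d p) d l d' p'
    s-update : ∀ {d l d' e p p'} → Step p d l d' p' → Step (cupdate e p) d l e p'
    s-plusl  : ∀ {d l d' p q p'} → Step p d l d' p' → Step (cplus p q) d l d' p'
    s-plusr  : ∀ {d l d' p q p'} → Step p d l d' p' → Step (cplus q p) d l d' p'

  Symmetric : (CTerm → CTerm → Set) → Set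
  Symmetric R = ∀ {p q} → R p q → R q p

  IsBisimulation : (CTerm → CTerm → Set) → Set
  IsBisimulation R = Symmetric R ×
    (∀ {p q} → R p q → ∀ {d l d' p'} → Step p d l d' p' →
       Σ CTerm (λ q' → Step q d l d' q' × R p' q'))

  Bisimilar : CTerm → CTerm → Set₁
  Bisimilar p q = Σ (CTerm → CTerm → Set) (λ R → IsBisimulation R × R p q)

  OpenBisimilar : Term → Term → Set₁
  OpenBisimilar s t = (σ : ℕ → CTerm) (δ : ℕ → DVal) → Bisimilar (close σ δ s) (close σ δ t)

-- Derivable equality, restricted to closed instances, is itself a bisimulation.
-- Every operator of the signature preserves "every step is matched up to R", and
-- every axiom instance is matched step for step with syntactically identical
-- residuals. For the expansion law l.x = Σ_d update(d, check(d, l.x)), the summand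
-- for d reproduces exactly the transition (d, l, d) of l.x.
module Submission where

open import Defs
open import Data.Nat using (ℕ)
open import Data.List using (List; []; _∷_; map; allFin)
open import Data.List.Membership.Propositional using (_∈_)
open import Data.List.Membership.Propositional.Properties using (∈-map⁺; ∈-map⁻; ∈-allFin)
open import Data.List.Relation.Unary.Any using (here; there)
open import Data.Product using (Σ; _×_; _,_; proj₁; swap)
open import Data.Empty using (⊥-elim)
open import Relation.Binary.Core using (_⇒_)
open import Relation.Binary.Definitions using (Reflexive; Transitive)
open import Relation.Binary.PropositionalEquality using (_≡_; refl; cong; cong₂)

module Soundness (n : ℕ) (L : Set) where

  private
    C : Set
    C = CTerm n L

    ⟦_⟧ : Term n L → (ℕ → C) → (ℕ → DVal n L) → C
    ⟦ t ⟧ σ δ = close n L σ δ t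

  SimulatedBy : (C → C → Set) → C → C → Set
  SimulatedBy R p q =
    ∀ {d l d' p'} → Step n L p d l d' p' → Σ C (λ q' → Step n L q d l d' q' × R p' q')

  module _ {R : C → C → Set} where

    simulatedBy-refl : Reflexive R → ∀ {p} → SimulatedBy R p p
    simulatedBy-refl R-refl s = _ , s , R-refl

    simulatedBy-trans : Transitive R → ∀ {p q r} →
                        SimulatedBy R p q → SimulatedBy R q r → SimulatedBy R p r
    simulatedBy-trans R-trans p≤q q≤r s with p≤q s
    ... | q' , s₁ , Rpq with q≤r s₁
    ... | r' , s₂ , Rqr = r' , s₂ , R-trans Rpq Rqr

    simulatedBy-map : ∀ {S} → R ⇒ S → ∀ {p q} → SimulatedBy R p q → SimulatedBy S p q
    simulatedBy-map R⇒S p≤q s with p≤q s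
    ... | q' , s' , r = q' , s' , R⇒S r

    simulatedBy-act : ∀ l {p q} → R p q → SimulatedBy R (cact l p) (cact l q)
    simulatedBy-act l r s-act = _ , s-act , r

    simulatedBy-check : ∀ e {p q} → SimulatedBy R p q →
                        SimulatedBy R (ccheck e p) (ccheck e q)
    simulatedBy-check e p≤q (s-check s) with p≤q s
    ... | q' , s' , r = q' , s-check s' , r

    simulatedBy-update : ∀ e {p q} → SimulatedBy R p q →
                         SimulatedBy R (cupdate e p) (cupdate e q)
    simulatedBy-update e p≤q (s-update s) with p≤q s
    ... | q' , s' , r = q' , s-update s' , r

    simulatedBy-plus : ∀ {p p' q q'} → SimulatedBy R p p' → SimulatedBy R q q' →
                       SimulatedBy R (cplus p q) (cplus p' q')
    simulatedBy-plus p≤p' q≤q' (s-plusl s) with p≤p' s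
    ... | r' , s' , r = r' , s-plusl s' , r
    simulatedBy-plus p≤p' q≤q' (s-plusr s) with q≤q' s
    ... | r' , s' , r = r' , s-plusr s' , r

  step-sumT⁺ : ∀ σ δ (ts : List (Term n L)) {t} → t ∈ ts →
               ∀ {d l d' p} → Step n L (⟦ t ⟧ σ δ) d l d' p →
               Step n L (⟦ sumT n L ts ⟧ σ δ) d l d' p
  step-sumT⁺ σ δ (t ∷ [])     (here refl) s = s
  step-sumT⁺ σ δ (t ∷ u ∷ ts) (here refl) s = s-plusl s
  step-sumT⁺ σ δ (t ∷ u ∷ ts) (there t∈ts) s = s-plusr (step-sumT⁺ σ δ (u ∷ ts) t∈ts s)

  step-sumT⁻ : ∀ σ δ (ts : List (Term n L)) {d l d' p} →
               Step n L (⟦ sumT n L ts ⟧ σ δ) d l d' p →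
               Σ (Term n L) (λ t → t ∈ ts × Step n L (⟦ t ⟧ σ δ) d l d' p)
  step-sumT⁻ σ δ (t ∷ [])     s           = t , here refl , s
  step-sumT⁻ σ δ (t ∷ u ∷ ts) (s-plusl s) = t , here refl , s
  step-sumT⁻ σ δ (t ∷ u ∷ ts) (s-plusr s) with step-sumT⁻ σ δ (u ∷ ts) s
  ... | t' , t'∈ts , s' = t' , there t'∈ts , s'

  expansionSummand : L → DVal n L → Term n L
  expansionSummand l d = update (dconst d) (check (dconst d) (act l (x n L)))

  ax-simulatedBy : ∀ {s t} → Ax n L s t → ∀ σ δ → SimulatedBy _≡_ (⟦ s ⟧ σ δ) (⟦ t ⟧ σ δ)
  ax-simulatedBy A1 σ δ (s-plusl s)                 = _ , s-plusr s , refl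
  ax-simulatedBy A1 σ δ (s-plusr s)                 = _ , s-plusl s , refl
  ax-simulatedBy A2 σ δ (s-plusl s)                 = _ , s-plusl (s-plusl s) , refl
  ax-simulatedBy A2 σ δ (s-plusr (s-plusl s))       = _ , s-plusl (s-plusr s) , refl
  ax-simulatedBy A2 σ δ (s-plusr (s-plusr s))       = _ , s-plusr s , refl
  ax-simulatedBy A3 σ δ (s-plusl s)                 = _ , s , refl
  ax-simulatedBy A3 σ δ (s-plusr s)                 = _ , s , refl
  ax-simulatedBy A4 σ δ (s-plusl s)                 = _ , s , refl
  ax-simulatedBy C1 σ δ (s-check (s-plusl s))       = _ , s-plusl (s-check s) , refl
  ax-simulatedBy C1 σ δ (s-check (s-plusr s))       = _ , s-plusr (s-check s) , refl
  ax-simulatedBy U1 σ δ (s-update (s-plusl s))      = _ , s-plusl (s-update s) , refl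
  ax-simulatedBy U1 σ δ (s-update (s-plusr s))      = _ , s-plusr (s-update s) , refl
  ax-simulatedBy CU σ δ (s-check (s-update s))      = _ , s-update (s-check s) , refl
  ax-simulatedBy UU σ δ (s-update (s-update s))     = _ , s-update s , refl
  ax-simulatedBy (CC d) σ δ (s-check (s-check s))   = _ , s-check s , refl
  ax-simulatedBy (CC0 d .d d≢d) σ δ (s-check (s-check s)) = ⊥-elim (d≢d refl)
  ax-simulatedBy (Act l) σ δ {d} s-act =
    _ , step-sumT⁺ σ δ _ (∈-map⁺ (expansionSummand l) (∈-allFin d)) (s-update (s-check s-act))
      , refl

  ax-simulatedBy⁻ : ∀ {s t} → Ax n L s t → ∀ σ δ → SimulatedBy _≡_ (⟦ t ⟧ σ δ) (⟦ s ⟧ σ δ)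
  ax-simulatedBy⁻ A1 σ δ (s-plusl s)                = _ , s-plusr s , refl
  ax-simulatedBy⁻ A1 σ δ (s-plusr s)                = _ , s-plusl s , refl
  ax-simulatedBy⁻ A2 σ δ (s-plusl (s-plusl s))      = _ , s-plusl s , refl
  ax-simulatedBy⁻ A2 σ δ (s-plusl (s-plusr s))      = _ , s-plusr (s-plusl s) , refl
  ax-simulatedBy⁻ A2 σ δ (s-plusr s)                = _ , s-plusr (s-plusr s) , refl
  ax-simulatedBy⁻ A3 σ δ s                          = _ , s-plusl s , refl
  ax-simulatedBy⁻ A4 σ δ s                          = _ , s-plusl s , refl
  ax-simulatedBy⁻ C1 σ δ (s-plusl (s-check s))      = _ , s-check (s-plusl s) , refl
  ax-simulatedBy⁻ C1 σ δ (s-plusr (s-check s))      = _ , s-check (s-plusr s) , refl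
  ax-simulatedBy⁻ U1 σ δ (s-plusl (s-update s))     = _ , s-update (s-plusl s) , refl
  ax-simulatedBy⁻ U1 σ δ (s-plusr (s-update s))     = _ , s-update (s-plusr s) , refl
  ax-simulatedBy⁻ CU σ δ (s-update (s-check s))     = _ , s-check (s-update s) , refl
  ax-simulatedBy⁻ UU σ δ (s-update s)               = _ , s-update (s-update s) , refl
  ax-simulatedBy⁻ (CC d) σ δ (s-check s)            = _ , s-check (s-check s) , refl
  ax-simulatedBy⁻ (CC0 d d' d≢d') σ δ ()
  ax-simulatedBy⁻ (Act l) σ δ s with step-sumT⁻ σ δ (map (expansionSummand l) (allFin n)) s
  ... | t , t∈ts , s' with ∈-map⁻ (expansionSummand l) t∈ts
  ... | d , _ , refl with s'
  ... | s-update (s-check s-act) = _ , s-act , refl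

  data ClosedDerivable : C → C → Set where
    cinst  : ∀ {s t} → Ax n L s t → ∀ σ δ → ClosedDerivable (⟦ s ⟧ σ δ) (⟦ t ⟧ σ δ)
    crefl  : ∀ {p} → ClosedDerivable p p
    csym   : ∀ {p q} → ClosedDerivable p q → ClosedDerivable q p
    ctrans : ∀ {p q r} → ClosedDerivable p q → ClosedDerivable q r → ClosedDerivable p r
    ccong-act    : ∀ {p q} l → ClosedDerivable p q → ClosedDerivable (cact l p) (cact l q)
    ccong-check  : ∀ {p q} e → ClosedDerivable p q → ClosedDerivable (ccheck e p) (ccheck e q)
    ccong-update : ∀ {p q} e → ClosedDerivable p q → ClosedDerivable (cupdate e p) (cupdate e q)
    ccong-plus   : ∀ {p p' q q'} → ClosedDerivable p p' → ClosedDerivable q q' →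
                   ClosedDerivable (cplus p q) (cplus p' q')

  closedDerivable-simulatedBy : ∀ {p q} → ClosedDerivable p q →
    SimulatedBy ClosedDerivable p q × SimulatedBy ClosedDerivable q p
  closedDerivable-simulatedBy (cinst ax σ δ) =
    simulatedBy-map ≡⇒derivable (ax-simulatedBy ax σ δ) ,
    simulatedBy-map ≡⇒derivable (ax-simulatedBy⁻ ax σ δ)
    where
      ≡⇒derivable : _≡_ ⇒ ClosedDerivable
      ≡⇒derivable refl = crefl
  closedDerivable-simulatedBy crefl =
    simulatedBy-refl {R = ClosedDerivable} crefl , simulatedBy-refl {R = ClosedDerivable} crefl
  closedDerivable-simulatedBy (csym p~q) = swap (closedDerivable-simulatedBy p~q)
  closedDerivable-simulatedBy (ctrans p~q q~r)
    with closedDerivable-simulatedBy p~q | closedDerivable-simulatedBy q~r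
  ... | p≤q , q≤p | q≤r , r≤q =
    simulatedBy-trans ctrans p≤q q≤r , simulatedBy-trans ctrans r≤q q≤p
  closedDerivable-simulatedBy (ccong-act l p~q) =
    simulatedBy-act l p~q , simulatedBy-act l (csym p~q)
  closedDerivable-simulatedBy (ccong-check e p~q) with closedDerivable-simulatedBy p~q
  ... | p≤q , q≤p = simulatedBy-check e p≤q , simulatedBy-check e q≤p
  closedDerivable-simulatedBy (ccong-update e p~q) with closedDerivable-simulatedBy p~q
  ... | p≤q , q≤p = simulatedBy-update e p≤q , simulatedBy-update e q≤p
  closedDerivable-simulatedBy (ccong-plus p~p' q~q')
    with closedDerivable-simulatedBy p~p' | closedDerivable-simulatedBy q~q'
  ... | p≤p' , p'≤p | q≤q' , q'≤q =
    simulatedBy-plus p≤p' q≤q' , simulatedBy-plus p'≤p q'≤q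

  closedDerivable-isBisimulation : IsBisimulation n L ClosedDerivable
  closedDerivable-isBisimulation = csym , λ p~q → proj₁ (closedDerivable-simulatedBy p~q)

  dclose-dsub : ∀ δ δ' (e : DTerm n L) →
                dclose n L δ (dsub n L δ' e) ≡ dclose n L (λ i → dclose n L δ (δ' i)) e
  dclose-dsub δ δ' (dconst d) = refl
  dclose-dsub δ δ' (dvar i)   = refl

  close-sub : ∀ σ δ σ' δ' (t : Term n L) →
              ⟦ sub n L σ' δ' t ⟧ σ δ ≡ ⟦ t ⟧ (λ i → ⟦ σ' i ⟧ σ δ) (λ i → dclose n L δ (δ' i))
  close-sub σ δ σ' δ' (pvar i)     = refl
  close-sub σ δ σ' δ' nil          = refl
  close-sub σ δ σ' δ' (act l t)    = cong (cact l) (close-sub σ δ σ' δ' t)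
  close-sub σ δ σ' δ' (check e t)  = cong₂ ccheck (dclose-dsub δ δ' e) (close-sub σ δ σ' δ' t)
  close-sub σ δ σ' δ' (update e t) = cong₂ cupdate (dclose-dsub δ δ' e) (close-sub σ δ σ' δ' t)
  close-sub σ δ σ' δ' (plus t u)   = cong₂ cplus (close-sub σ δ σ' δ' t) (close-sub σ δ σ' δ' u)

  derivable⇒closedDerivable : ∀ {s t} → Derivable n L s t →
                              ∀ σ δ → ClosedDerivable (⟦ s ⟧ σ δ) (⟦ t ⟧ σ δ)
  derivable⇒closedDerivable (inst {s} {t} ax σ' δ') σ δ
    rewrite close-sub σ δ σ' δ' s | close-sub σ δ σ' δ' t = cinst ax _ _
  derivable⇒closedDerivable refl'              σ δ = crefl
  derivable⇒closedDerivable (sym' s=t)         σ δ = csym (derivable⇒closedDerivable s=t σ δ)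
  derivable⇒closedDerivable (trans' s=t t=u)   σ δ =
    ctrans (derivable⇒closedDerivable s=t σ δ) (derivable⇒closedDerivable t=u σ δ)
  derivable⇒closedDerivable (cong-act l s=t)    σ δ = ccong-act l (derivable⇒closedDerivable s=t σ δ)
  derivable⇒closedDerivable (cong-check e s=t)  σ δ = ccong-check _ (derivable⇒closedDerivable s=t σ δ)
  derivable⇒closedDerivable (cong-update e s=t) σ δ = ccong-update _ (derivable⇒closedDerivable s=t σ δ)
  derivable⇒closedDerivable (cong-plus s=s' t=t') σ δ =
    ccong-plus (derivable⇒closedDerivable s=s' σ δ) (derivable⇒closedDerivable t=t' σ δ)

mainTheorem2 : (n : ℕ) (L : Set) (s t : Term n L) → Derivable n L s t → OpenBisimilar n L s t
mainTheorem2 n L s t s=t σ δ =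
  ClosedDerivable , closedDerivable-isBisimulation , derivable⇒closedDerivable s=t σ δ
  where open Soundness n L
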